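{- For every finite ordered tree $S$, the Ramsey degree of $S$ in the category $Conn_T$ satisfies $$rd(S)\geq\left|\mathcal{P}\big(\{x\in S\colon x\text{ is not the root of }S\text{ and }x\text{ has at most one immediate successor in }S\}\big)\right|.$$
   Context: All trees are finite. A tree is a partial order $(T,\sqsubseteq_T)$ with a least element (the root) such that the predecessors of every element are linearly ordered; $v\wedge_T w$ is the largest common predecessor. A tree is ordered if each set of immediate successors carries a linear order; this induces a linear order $\leq_T$ on $T$: $v\leq_T w$ iff $v\sqsubseteq_T w$, or $w\not\sqsubseteq_T v$ and the immediate successor of $v\wedge w$ below $v$ precedes the one below $w$. An embedding $i\colon S\to T$ sends root to root, satisfies $x<_S y\Rightarrow i(x)<_T i(y)$, and $i(x\wedge y)=i(x)\wedge i(y)$. A map $s\colon T\to S$ is a rigid surjection if there is an embedding $i\colon S\to T$ with $s(i(x))=x$ and $i(s(y))\sqsubseteq_T y$ for all $x,y$; then $i=i_s$, $i_s(x)=\bigwedge s^{ -1}(x)$. A connection $(s,i)\colon T\leftrightarrows S$ is a pair with $s\colon T\to S$ a rigid surjection, $i\colon S\to T$ an embedding, and for all $x\in S$: $s(i(x))=x$ and $s(y)\leq_S x$ for all $y<_T i(x)$. $Conn_T$ is the category whose objects are finite ordered trees, with $\mathrm{Hom}(S,T)$ the set of connections $(s,i)\colon T\leftrightarrows S$, and composition $(t,j)\circ(s,i)=(s\circ t, j\circ i)$. For objects $A,B$, $rd(A,B)$ is the least $k$ such that for every $r>0$ there is an object $C$ such that for every $r$-coloring of $\mathrm{Hom}(A,C)$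 there is $f\in\mathrm{Hom}(B,C)$ with at most $k$ colors on $f\circ\mathrm{Hom}(A,B)$; $rd(A)=\sup_B rd(A,B)$. -}

module Defs where

open import Data.Nat using (ℕ; zero; suc; _≤_; _<_; _≤?_; _^_; _≟_)
open import Data.Bool using (Bool; true; false; T; if_then_else_)
open import Data.Unit using (⊤; tt)
open import Data.Maybe using (Maybe; just; nothing; is-just; maybe)
open import Data.List using (List; []; _∷_; length; map; _++_; filter)
open import Data.List.Membership.Propositional using (_∈_)
open import Data.Fin using (Fin)
open import Data.Product using (Σ; ∃; _×_; _,_; proj₁; proj₂)
open import Relation.Binary.PropositionalEquality using (_≡_; _≢_)
open import Relation.Nullary using (Dec; yes; no; ¬_)
open import Relation.Nullary.Decidable using (_×-dec_)

-- Finite ordered trees: rose trees; the list order of the children is the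
-- linear order on each set of immediate successors.

data Tree : Set where
  node : List Tree → Tree

children : Tree → List Tree
children (node ts) = ts

-- Nodes are addressed by paths (lists of child indices) from the root.
_!?_ : {A : Set} → List A → ℕ → Maybe A
[]       !? _     = nothing
(x ∷ xs) !? zero  = just x
(x ∷ xs) !? suc n = xs !? n

subAt : Tree → List ℕ → Maybe Tree
subAt t [] = just t
subAt (node ts) (a ∷ p) with ts !? a
... | just t  = subAt t p
... | nothing = nothing

IsNode : Tree → List ℕ → Set
IsNode t p = T (is-just (subAt t p))

Node : Tree → Set
Node t = Σ (List ℕ) (IsNode t)

path : {t : Tree} → Node t → List ℕ
path = proj₁

rootN : (t : Tree) → Node t
rootN t = [] , tt

-- Tree order ⊑ (x is a predecessor of y  iff  path x is a prefix of path y)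

data _⊑_ : List ℕ → List ℕ → Set where
  []⊑ : ∀ {q} → [] ⊑ q
  ∷⊑  : ∀ {a p q} → p ⊑ q → (a ∷ p) ⊑ (a ∷ q)

-- Meet v ∧ w (largest common predecessor) = longest common prefix.
lcp : List ℕ → List ℕ → List ℕ
lcp [] _ = []
lcp (a ∷ p) [] = []
lcp (a ∷ p) (b ∷ q) with a ≟ b
... | yes _ = a ∷ lcp p q
... | no _  = []

lcp-node : ∀ t p q → IsNode t p → IsNode t (lcp p q)
lcp-node t [] q h = tt
lcp-node t (a ∷ p) [] h = tt
lcp-node (node ts) (a ∷ p) (b ∷ q) h with a ≟ b
lcp-node (node ts) (a ∷ p) (b ∷ q) h | no _ = tt
lcp-node (node ts) (a ∷ p) (b ∷ q) h | yes _ with ts !? a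
... | just t  = lcp-node t p q h
... | nothing = h

meet : {t : Tree} → Node t → Node t → Node t
meet {t} (p , hp) (q , _) = lcp p q , lcp-node t p q hp

-- The induced linear order ≤_T: v ≤ w iff v ⊑ w, or the immediate successor
-- of v ∧ w below v precedes the one below w (lexicographic order on paths,
-- a path being below all its extensions).

data _≤L_ : List ℕ → List ℕ → Set where
  nil≤ : ∀ {q} → [] ≤L q
  lt≤  : ∀ {a b p q} → a < b → (a ∷ p) ≤L (b ∷ q)
  eq≤  : ∀ {a p q} → p ≤L q → (a ∷ p) ≤L (a ∷ q)

_<L_ : List ℕ → List ℕ → Set
p <L q = p ≤L q × p ≢ q

record IsEmbedding {S T : Tree} (i : Node S → Node T) : Set where
  field
    root↦root : path (i (rootN S)) ≡ []
    strict    : ∀ x y → path x <L path y → path (i x) <L path (i y)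
    meet-pres : ∀ x y → path (i (meet x y)) ≡ path (meet (i x) (i y))

IsRigidSurj : {T S : Tree} → (Node T → Node S) → Set
IsRigidSurj {T} {S} s =
  Σ (Node S → Node T) λ i →
    IsEmbedding i
    × (∀ x → path (s (i x)) ≡ path x)
    × (∀ y → path (i (s y)) ⊑ path y)

record Connection (T S : Tree) : Set where
  field
    s       : Node T → Node S
    i       : Node S → Node T
    s-rigid : IsRigidSurj s
    i-emb   : IsEmbedding i
    section : ∀ x → path (s (i x)) ≡ path x
    below   : ∀ x y → path y <L path (i x) → path (s y) ≤L path x

Hom : Tree → Tree → Set
Hom S T = Connection T S

_≈H_ : {S T : Tree} → Hom S T → Hom S T → Set
f ≈H g = (∀ y → path (Connection.s f y) ≡ path (Connection.s g y))
       × (∀ x → path (Connection.i f x) ≡ path (Connection.i g x))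

IsComp : {A B C : Tree} → Hom A C → Hom B C → Hom A B → Set
IsComp h f g =
    (∀ y → path (Connection.s h y) ≡ path (Connection.s g (Connection.s f y)))
  × (∀ x → path (Connection.i h x) ≡ path (Connection.i f (Connection.i g x)))

Coloring : Tree → Tree → ℕ → Set
Coloring A C r = Σ (Hom A C → Fin r) λ c → ∀ h h' → h ≈H h' → c h ≡ c h'

RamseyBound : Tree → Tree → ℕ → Set
RamseyBound A B k =
  ∀ (r : ℕ) → 0 < r →
  Σ Tree λ C →
    ∀ (c : Coloring A C r) →
    Σ (Hom B C) λ f →
    Σ (List (Fin r)) λ L →
      length L ≤ k
      × (∀ (g : Hom A B) (h : Hom A C) → IsComp h f g → proj₁ c h ∈ L)

-- rd(A) = sup_B rd(A,B) ≥ N, i.e. every k with rd(A,B) ≤ k for all B is ≥ N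
RdAtLeast : Tree → ℕ → Set
RdAtLeast A N = ∀ k → (∀ B → RamseyBound A B k) → N ≤ k

allPaths  : Tree → List (List ℕ)
allPathsL : ℕ → List Tree → List (List ℕ)
allPaths (node ts) = [] ∷ allPathsL 0 ts
allPathsL i [] = []
allPathsL i (t ∷ ts) = map (i ∷_) (allPaths t) ++ allPathsL (suc i) ts

succCount : Tree → List ℕ → ℕ
succCount t p = maybe (λ u → length (children u)) 0 (subAt t p)

nonRoot? : (p : List ℕ) → Dec (p ≢ [])
nonRoot? [] = no (λ h → h _≡_.refl)
nonRoot? (_ ∷ _) = yes (λ ())

lowSet : Tree → List (List ℕ)
lowSet t = filter (λ p → nonRoot? p ×-dec (succCount t p ≤? 1)) (allPaths t)

powerSetSize : Tree → ℕ
powerSetSize t = 2 ^ length (lowSet t)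

{-# OPTIONS --safe #-}

-- Let X be the set of non-root nodes of S with at most one immediate successor. Build sprout S by
-- giving every node two new leaves, which make it a fork, and subdividing every edge. For Y ⊆ X
-- there is a connection g_Y : sprout S ⇆ S whose embedding ι sends each node to its copy, and
-- whose rigid surjection has as witness the map that agrees with ι except on Y, where it moves up
-- to the subdivision node; this still preserves meets because the nodes of Y do not branch.
-- Colour h ∈ Hom(S, C) by the set of x ∈ X at which the rigid witness of h differs from its
-- embedding. For any connection f the witness lies below the embedding, equals it at forks such
-- as the copies ι x, and is injective, so the colour of f ∘ g_Y is exactly Y. Hence f ∘ Hom(S, sprout S)
-- always meets all 2^|X| colours.

module Submission where

open import Defs

open import Data.Bool using (Bool; true; false; T; not; _∧_; if_then_else_)
open import Data.Bool.Properties using (T?; T-irrelevant; T-≡; T-∧; ∧-identityʳ)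
open import Data.Empty using (⊥-elim)
open import Data.Unit using (tt)
open import Data.Fin using (Fin; zero; suc; combine; remQuot)
open import Data.Fin.Properties using (2↔Bool; combine-remQuot; injective⇒≤)
open import Data.List using (List; []; _∷_; _++_; map; length; lookup)
open import Data.List.Membership.Propositional using (_∈_)
open import Data.List.Membership.Propositional.Properties using (∈-filter⁻; ∈-map⁻; ∈-++⁻)
open import Data.List.Properties using (≡-dec; ∷-injectiveˡ; ∷-injectiveʳ; ++-identityʳ-unique)
open import Data.List.Relation.Unary.All as All using (All)
open import Data.List.Relation.Unary.AllPairs using ([]; _∷_)
open import Data.List.Relation.Unary.Any using (here; there)
open import Data.List.Relation.Unary.Any.Properties using (lookup-index)
open import Data.List.Relation.Unary.Unique.Propositional using (Unique)
import Data.List.Relation.Unary.Unique.Propositional.Properties as Unique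
open import Data.Maybe using (just; is-just; maybe)
open import Data.Nat using (ℕ; zero; suc; _+_; _≤_; _<_; _≟_; _≤?_; _≤ᵇ_; _^_; z≤n; s≤s)
open import Data.Nat.Properties
  using (suc-injective; <-cmp; <-irrefl; <-≤-trans; ≤-trans; n<1⇒n≡0; m≤m+n; +-identityʳ; +-suc; m^n>0;
         ≤ᵇ⇒≤; ≤⇒≤ᵇ)
open import Data.Product using (∃; _×_; _,_; proj₁; proj₂)
open import Data.Sum using (_⊎_; inj₁; inj₂)
open import Function using (_∘_; Inverse; Equivalence)
open import Relation.Binary using (tri<; tri≈; tri>)
open import Relation.Binary.Definitions using (DecidableEquality)
open import Relation.Binary.PropositionalEquality
open import Relation.Nullary using (yes; no; ¬_; does)
open import Relation.Nullary.Decidable using (dec-true; dec-false; _×-dec_)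

private variable
  a b c : ℕ
  p q r : List ℕ
  t : Tree
  ts : List Tree

_≟ₚ_ : DecidableEquality (List ℕ)
_≟ₚ_ = ≡-dec _≟_

⊑-refl : ∀ p → p ⊑ p
⊑-refl [] = []⊑
⊑-refl (a ∷ p) = ∷⊑ (⊑-refl p)

⊑-trans : p ⊑ q → q ⊑ r → p ⊑ r
⊑-trans []⊑ _ = []⊑
⊑-trans (∷⊑ h) (∷⊑ k) = ∷⊑ (⊑-trans h k)

⊑-antisym : p ⊑ q → q ⊑ p → p ≡ q
⊑-antisym []⊑ []⊑ = refl
⊑-antisym (∷⊑ h) (∷⊑ k) = cong (_ ∷_) (⊑-antisym h k)

p⊑p++q : ∀ p q → p ⊑ (p ++ q)
p⊑p++q [] q = []⊑
p⊑p++q (a ∷ p) q = ∷⊑ (p⊑p++q p q)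

⊑⇒≤L : p ⊑ q → p ≤L q
⊑⇒≤L []⊑ = nil≤
⊑⇒≤L (∷⊑ h) = eq≤ (⊑⇒≤L h)

≤L-refl : ∀ p → p ≤L p
≤L-refl p = ⊑⇒≤L (⊑-refl p)

≤L-total : ∀ p q → p ≤L q ⊎ q ≤L p
≤L-total [] q = inj₁ nil≤
≤L-total (a ∷ p) [] = inj₂ nil≤
≤L-total (a ∷ p) (b ∷ q) with <-cmp a b
... | tri< a<b _ _ = inj₁ (lt≤ a<b)
... | tri> _ _ b<a = inj₂ (lt≤ b<a)
... | tri≈ _ refl _ with ≤L-total p q
...   | inj₁ p≤q = inj₁ (eq≤ p≤q)
...   | inj₂ q≤p = inj₂ (eq≤ q≤p)

≤L⇒<L⊎≡ : p ≤L q → p <L q ⊎ p ≡ q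
≤L⇒<L⊎≡ {p} {q} p≤q with p ≟ₚ q
... | yes p≡q = inj₂ p≡q
... | no p≢q = inj₁ (p≤q , p≢q)

lcp-∷ : ∀ a p q → lcp (a ∷ p) (a ∷ q) ≡ a ∷ lcp p q
lcp-∷ a p q with a ≟ a
... | yes _ = refl
... | no a≢a = ⊥-elim (a≢a refl)

lcp-∷-≢ : a ≢ b → lcp (a ∷ p) (b ∷ q) ≡ []
lcp-∷-≢ {a} {b} a≢b with a ≟ b
... | yes a≡b = ⊥-elim (a≢b a≡b)
... | no _ = refl

lcp-⊑ʳ : ∀ p q → lcp p q ⊑ q
lcp-⊑ʳ [] q = []⊑
lcp-⊑ʳ (a ∷ p) [] = []⊑
lcp-⊑ʳ (a ∷ p) (b ∷ q) with a ≟ b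
... | yes refl = ∷⊑ (lcp-⊑ʳ p q)
... | no _ = []⊑

⊑⇒lcp≡ : p ⊑ q → lcp p q ≡ p
⊑⇒lcp≡ []⊑ = refl
⊑⇒lcp≡ (∷⊑ {a} {p} {q} h) = trans (lcp-∷ a p q) (cong (a ∷_) (⊑⇒lcp≡ h))

lcp≡⇒⊑ : lcp p q ≡ p → p ⊑ q
lcp≡⇒⊑ {p} {q} e = subst (_⊑ q) e (lcp-⊑ʳ p q)

lcp-extensions : ∀ {p₁ p₂ q₁ q₂} → lcp p₁ p₂ ≢ p₁ → lcp p₁ p₂ ≢ p₂ →
                 p₁ ⊑ q₁ → p₂ ⊑ q₂ → lcp q₁ q₂ ≡ lcp p₁ p₂
lcp-extensions ≢p₁ ≢p₂ []⊑ _ = ⊥-elim (≢p₁ refl)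
lcp-extensions ≢p₁ ≢p₂ (∷⊑ _) []⊑ = ⊥-elim (≢p₂ refl)
lcp-extensions {a ∷ p₁} {b ∷ p₂} ≢p₁ ≢p₂ (∷⊑ h) (∷⊑ k) with a ≟ b
... | no _ = refl
... | yes refl = cong (a ∷_) (lcp-extensions (≢p₁ ∘ cong (a ∷_)) (≢p₂ ∘ cong (a ∷_)) h k)

path-injective : {x y : Node t} → path x ≡ path y → x ≡ y
path-injective {x = p , hp} {y = .p , hq} refl = cong (p ,_) (T-irrelevant hp hq)

path-cong : {S T : Tree} (φ : Node S → Node T) {x y : Node S} →
            path x ≡ path y → path (φ x) ≡ path (φ y)
path-cong φ = cong (path ∘ φ) ∘ path-injective

subAt-∷ : ∀ ts a p {t} → ts !? a ≡ just t → subAt (node ts) (a ∷ p) ≡ subAt t p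
subAt-∷ ts a p e rewrite e = refl

succCount-∷ : ∀ ts a p {t} → ts !? a ≡ just t → succCount (node ts) (a ∷ p) ≡ succCount t p
succCount-∷ ts a p = cong (maybe (length ∘ children) 0) ∘ subAt-∷ ts a p

IsNode-∷⁺ : ∀ ts a p {t} → ts !? a ≡ just t → IsNode t p → IsNode (node ts) (a ∷ p)
IsNode-∷⁺ ts a p e = subst (T ∘ is-just) (sym (subAt-∷ ts a p e))

IsNode-child : ∀ ts a p {t} → ts !? a ≡ just t → IsNode (node ts) (a ∷ p) → IsNode t p
IsNode-child ts a p e = subst (T ∘ is-just) (subAt-∷ ts a p e)

IsNode-∷⁻ : ∀ ts a p → IsNode (node ts) (a ∷ p) → ∃ λ t → ts !? a ≡ just t × IsNode t p
IsNode-∷⁻ ts a p h with ts !? a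
... | just t = t , refl , h

IsNode-⊑ : p ⊑ q → IsNode t q → IsNode t p
IsNode-⊑ []⊑ _ = tt
IsNode-⊑ {t = node ts} (∷⊑ {a} {p} {q} p⊑q) h with IsNode-∷⁻ ts a q h
... | t , e , hq = IsNode-∷⁺ ts a p e (IsNode-⊑ p⊑q hq)

module _ {S T : Tree} {i : Node S → Node T} (E : IsEmbedding i) where
  open IsEmbedding E

  embedding-⊑ : ∀ x y → path x ⊑ path y → path (i x) ⊑ path (i y)
  embedding-⊑ x y x⊑y = lcp≡⇒⊑ (begin
    lcp (path (i x)) (path (i y)) ≡⟨ meet-pres x y ⟨
    path (i (meet x y))           ≡⟨ path-cong i (⊑⇒lcp≡ x⊑y) ⟩
    path (i x)                    ∎)
    where open ≡-Reasoning

  embedding-injective : ∀ x y → path (i x) ≡ path (i y) → path x ≡ path y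
  embedding-injective x y ix≡iy with path x ≟ₚ path y
  ... | yes x≡y = x≡y
  ... | no x≢y with ≤L-total (path x) (path y)
  ...   | inj₁ x≤y = ⊥-elim (proj₂ (strict x y (x≤y , x≢y)) ix≡iy)
  ...   | inj₂ y≤x = ⊥-elim (proj₂ (strict y x (y≤x , x≢y ∘ sym)) (sym ix≡iy))

∘-isEmbedding : {A B C : Tree} {i : Node A → Node B} {j : Node B → Node C} →
                IsEmbedding i → IsEmbedding j → IsEmbedding (j ∘ i)
∘-isEmbedding {i = i} {j} Ei Ej = record
  { root↦root = trans (path-cong j (Ei.root↦root)) Ej.root↦root
  ; strict    = λ x y → Ej.strict (i x) (i y) ∘ Ei.strict x y
  ; meet-pres = λ x y → trans (path-cong j (Ei.meet-pres x y)) (Ej.meet-pres (i x) (i y))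
  }
  where
  module Ei = IsEmbedding Ei
  module Ej = IsEmbedding Ej

rigidWitness-unique : {T S : Tree} {s s′ : Node T → Node S} (R : IsRigidSurj s) (R′ : IsRigidSurj s′) →
                      (∀ y → path (s y) ≡ path (s′ y)) → ∀ x → path (proj₁ R x) ≡ path (proj₁ R′ x)
rigidWitness-unique {s = s} {s′} (i , _ , si , is⊑) (i′ , _ , s′i′ , i′s′⊑) s≡s′ x =
  ⊑-antisym (subst (λ z → path (i z) ⊑ path (i′ x)) (path-injective (trans (s≡s′ (i′ x)) (s′i′ x)))
                   (is⊑ (i′ x)))
            (subst (λ z → path (i′ z) ⊑ path (i x)) (path-injective (trans (sym (s≡s′ (i x))) (si x)))
                   (i′s′⊑ (i x)))

module _ {T S : Tree} (f : Connection T S) where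
  open Connection f

  witness : Node S → Node T
  witness = proj₁ s-rigid

  witness-isEmbedding : IsEmbedding witness
  witness-isEmbedding = proj₁ (proj₂ s-rigid)

  s∘witness : ∀ x → path (s (witness x)) ≡ path x
  s∘witness = proj₁ (proj₂ (proj₂ s-rigid))

  witness∘s-⊑ : ∀ y → path (witness (s y)) ⊑ path y
  witness∘s-⊑ = proj₂ (proj₂ (proj₂ s-rigid))

  witness-⊑-i : ∀ x → path (witness x) ⊑ path (i x)
  witness-⊑-i x = subst (λ z → path (witness z) ⊑ path (i x)) (path-injective (section x)) (witness∘s-⊑ (i x))

  witness≡i-at-fork : ∀ v v₀ v₁ → path (meet v₀ v₁) ≡ path v → path v₀ ≢ path v → path v₁ ≢ path v →
                      path (witness v) ≡ path (i v)
  witness≡i-at-fork v v₀ v₁ v₀∧v₁≡v v₀≢v v₁≢v = begin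
    path (witness v)                             ≡⟨ path-cong witness v₀∧v₁≡v ⟨
    path (witness (meet v₀ v₁))                  ≡⟨ W.meet-pres v₀ v₁ ⟩
    lcp (path (witness v₀)) (path (witness v₁))  ≡⟨ lcp-extensions (split v₀ v₀≢v) (split v₁ v₁≢v)
                                                                   (witness-⊑-i v₀) (witness-⊑-i v₁) ⟨
    lcp (path (i v₀)) (path (i v₁))              ≡⟨ I.meet-pres v₀ v₁ ⟨
    path (i (meet v₀ v₁))                        ≡⟨ path-cong i v₀∧v₁≡v ⟩
    path (i v)                                   ∎
    where
    open ≡-Reasoning
    module W = IsEmbedding witness-isEmbedding
    module I = IsEmbedding i-emb
    split : ∀ u → path u ≢ path v → lcp (path (witness v₀)) (path (witness v₁)) ≢ path (witness u)
    split u u≢v e = u≢v (sym (trans (sym v₀∧v₁≡v)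
      (embedding-injective witness-isEmbedding (meet v₀ v₁) u (trans (W.meet-pres v₀ v₁) e))))

  witness≢i-below : ∀ u v → path u ⊑ path v → path u ≢ path v → path (witness u) ≢ path (i v)
  witness≢i-below u v u⊑v u≢v wu≡iv = u≢v (embedding-injective witness-isEmbedding u v
    (⊑-antisym (embedding-⊑ witness-isEmbedding u v u⊑v) (subst (path (witness v) ⊑_) (sym wu≡iv) (witness-⊑-i v))))

infixr 9 _∘ᶜ_

_∘ᶜ_ : {A B C : Tree} → Hom B C → Hom A B → Hom A C
f ∘ᶜ g = record
  { s       = G.s ∘ F.s
  ; i       = F.i ∘ G.i
  ; s-rigid = witness f ∘ witness g
            , ∘-isEmbedding (witness-isEmbedding g) (witness-isEmbedding f)
            , (λ x → trans (path-cong G.s (s∘witness f (witness g x))) (s∘witness g x))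
            , (λ y → ⊑-trans (embedding-⊑ (witness-isEmbedding f) _ _ (witness∘s-⊑ g (F.s y))) (witness∘s-⊑ f y))
  ; i-emb   = ∘-isEmbedding G.i-emb F.i-emb
  ; section = λ x → trans (path-cong G.s (F.section (G.i x))) (G.section x)
  ; below   = below
  }
  where
  module F = Connection f
  module G = Connection g
  below : ∀ x y → path y <L path (F.i (G.i x)) → path (G.s (F.s y)) ≤L path x
  below x y y<ix with ≤L⇒<L⊎≡ (F.below (G.i x) y y<ix)
  ... | inj₁ fy<gx = G.below x (F.s y) fy<gx
  ... | inj₂ fy≡gx = subst (_≤L path x) (sym (trans (path-cong G.s fy≡gx) (G.section x))) (≤L-refl (path x))

-- The new leaves are children 0 and 1; the subdivision node on the edge to child a is child a + 2.
sprout : Tree → Tree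
sproutChildren : List Tree → List Tree
sprout (node ts) = node (node [] ∷ node [] ∷ sproutChildren ts)
sproutChildren [] = []
sproutChildren (t ∷ ts) = node (sprout t ∷ []) ∷ sproutChildren ts

-- lift κ sends a node of t to its copy in sprout t, or, where κ holds, to the subdivision
-- node just above that copy.
lift : (List ℕ → Bool) → List ℕ → List ℕ
liftBelow : (List ℕ → Bool) → ℕ → List ℕ → List ℕ
lift κ [] = []
lift κ (a ∷ p) = suc (suc a) ∷ liftBelow κ a p
liftBelow κ a [] = if κ (a ∷ []) then [] else 0 ∷ []
liftBelow κ a (b ∷ p) = 0 ∷ lift (κ ∘ (a ∷_)) (b ∷ p)

ι : List ℕ → List ℕ
ι = lift (λ _ → false)

collapse : (List ℕ → Bool) → List ℕ → List ℕ
collapse κ (suc (suc a) ∷ []) = if κ (a ∷ []) then a ∷ [] else []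
collapse κ (suc (suc a) ∷ 0 ∷ r) = a ∷ collapse (κ ∘ (a ∷_)) r
collapse κ _ = []

collapse-lift : ∀ κ κ′ p → (κ′ p ≡ true → κ p ≡ true) → collapse κ (lift κ′ p) ≡ p
collapse-lift κ κ′ [] _ = refl
collapse-lift κ κ′ (a ∷ []) κ′⇒κ with κ′ (a ∷ [])
... | true rewrite κ′⇒κ refl = refl
... | false = refl
collapse-lift κ κ′ (a ∷ b ∷ p) κ′⇒κ = cong (a ∷_) (collapse-lift (κ ∘ (a ∷_)) (κ′ ∘ (a ∷_)) (b ∷ p) κ′⇒κ)

liftBelow-[]-⊑-0∷ : ∀ κ a r → liftBelow κ a [] ⊑ (0 ∷ r)
liftBelow-[]-⊑-0∷ κ a r with κ (a ∷ [])
... | true = []⊑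
... | false = ∷⊑ []⊑

liftBelow-[]-⊑ : ∀ κ a p → liftBelow κ a [] ⊑ liftBelow κ a p
liftBelow-[]-⊑ κ a [] = ⊑-refl _
liftBelow-[]-⊑ κ a (b ∷ p) = liftBelow-[]-⊑-0∷ κ a _

lift-collapse-⊑ : ∀ κ q → lift κ (collapse κ q) ⊑ q
lift-collapse-⊑ κ (suc (suc a) ∷ []) with κ (a ∷ []) in κa
... | true rewrite κa = ⊑-refl _
... | false = []⊑
lift-collapse-⊑ κ (suc (suc a) ∷ 0 ∷ r) with collapse (κ ∘ (a ∷_)) r | lift-collapse-⊑ (κ ∘ (a ∷_)) r
... | [] | _ = ∷⊑ (liftBelow-[]-⊑-0∷ κ a r)
... | b ∷ p | ih = ∷⊑ (∷⊑ ih)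
lift-collapse-⊑ κ [] = []⊑
lift-collapse-⊑ κ (0 ∷ _) = []⊑
lift-collapse-⊑ κ (1 ∷ _) = []⊑
lift-collapse-⊑ κ (suc (suc a) ∷ suc b ∷ r) = []⊑

lift-⊑-ι : ∀ κ p → lift κ p ⊑ ι p
lift-⊑-ι κ [] = []⊑
lift-⊑-ι κ (a ∷ []) with κ (a ∷ [])
... | true = ∷⊑ []⊑
... | false = ⊑-refl _
lift-⊑-ι κ (a ∷ b ∷ p) = ∷⊑ (∷⊑ (lift-⊑-ι (κ ∘ (a ∷_)) (b ∷ p)))

lift-≤L : ∀ κ → p ≤L q → lift κ p ≤L lift κ q
lift-≤L κ nil≤ = nil≤
lift-≤L κ (lt≤ a<b) = lt≤ (s≤s (s≤s a<b))
lift-≤L κ (eq≤ {a} {[]} {q} _) = eq≤ (⊑⇒≤L (liftBelow-[]-⊑ κ a q))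
lift-≤L κ (eq≤ {a} {b ∷ p} {c ∷ q} p≤q) = eq≤ (eq≤ (lift-≤L (κ ∘ (a ∷_)) p≤q))

lift-injective : ∀ κ p q → lift κ p ≡ lift κ q → p ≡ q
lift-injective κ p q e = begin
  p                       ≡⟨ collapse-lift κ κ p (λ κp → κp) ⟨
  collapse κ (lift κ p)   ≡⟨ cong (collapse κ) e ⟩
  collapse κ (lift κ q)   ≡⟨ collapse-lift κ κ q (λ κq → κq) ⟩
  q                       ∎
  where open ≡-Reasoning

lift-<L : ∀ κ → p <L q → lift κ p <L lift κ q
lift-<L κ (p≤q , p≢q) = lift-≤L κ p≤q , p≢q ∘ lift-injective κ _ _

lift-≡-ι : ∀ κ p → κ p ≡ false → lift κ p ≡ ι p
lift-≡-ι κ [] _ = refl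
lift-≡-ι κ (a ∷ []) κp rewrite κp = refl
lift-≡-ι κ (a ∷ b ∷ p) κp = cong (λ z → suc (suc a) ∷ 0 ∷ z) (lift-≡-ι (κ ∘ (a ∷_)) (b ∷ p) κp)

lift-≢-ι : ∀ κ p → p ≢ [] → κ p ≡ true → lift κ p ≢ ι p
lift-≢-ι κ [] p≢[] _ = ⊥-elim (p≢[] refl)
lift-≢-ι κ (a ∷ []) _ κp rewrite κp = λ ()
lift-≢-ι κ (a ∷ b ∷ p) _ κp = lift-≢-ι (κ ∘ (a ∷_)) (b ∷ p) (λ ()) κp ∘ ∷-injectiveʳ ∘ ∷-injectiveʳ

collapse-≤L-head : ∀ κ {x} r → c < a → collapse κ (suc (suc c) ∷ r) ≤L (a ∷ x)
collapse-≤L-head {c} κ [] c<a with κ (c ∷ [])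
... | true = lt≤ c<a
... | false = nil≤
collapse-≤L-head κ (0 ∷ r) c<a = lt≤ c<a
collapse-≤L-head κ (suc b ∷ r) c<a = nil≤

collapse-below-ι : ∀ κ x y → y <L ι x → collapse κ y ≤L x
collapse-below-ι κ [] .[] (nil≤ , y≢[]) = ⊥-elim (y≢[] refl)
collapse-below-ι κ (a ∷ x) [] _ = nil≤
collapse-below-ι κ (a ∷ x) (0 ∷ r) _ = nil≤
collapse-below-ι κ (a ∷ x) (1 ∷ r) _ = nil≤
collapse-below-ι κ (a ∷ x) (suc (suc c) ∷ r) (lt≤ (s≤s (s≤s c<a)) , _) = collapse-≤L-head κ r c<a
collapse-below-ι κ (a ∷ x) (suc (suc a) ∷ []) (eq≤ nil≤ , _) with κ (a ∷ [])
... | true = eq≤ nil≤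
... | false = nil≤
collapse-below-ι κ (a ∷ []) (suc (suc a) ∷ 0 ∷ []) (eq≤ (eq≤ nil≤) , _) = eq≤ nil≤
collapse-below-ι κ (a ∷ b ∷ x) (suc (suc a) ∷ 0 ∷ r) (eq≤ (eq≤ r≤ιbx) , y≢ιabx) =
  eq≤ (collapse-below-ι (κ ∘ (a ∷_)) (b ∷ x) r (r≤ιbx , y≢ιabx ∘ cong (λ z → suc (suc a) ∷ 0 ∷ z)))
collapse-below-ι κ (a ∷ []) (suc (suc a) ∷ suc b ∷ r) (eq≤ (lt≤ ()) , _)
collapse-below-ι κ (a ∷ b ∷ x) (suc (suc a) ∷ suc c ∷ r) (eq≤ (lt≤ ()) , _)

ι-∷ : ∀ a p → ι (a ∷ p) ≡ suc (suc a) ∷ 0 ∷ ι p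
ι-∷ a [] = refl
ι-∷ a (b ∷ p) = refl

sproutChildren-!? : ∀ ts a {t} → ts !? a ≡ just t → sproutChildren ts !? a ≡ just (node (sprout t ∷ []))
sproutChildren-!? (t ∷ ts) zero refl = refl
sproutChildren-!? (t ∷ ts) (suc a) e = sproutChildren-!? ts a e

sproutChildren-!?⁻ : ∀ ts a {u} → sproutChildren ts !? a ≡ just u →
                     ∃ λ t → ts !? a ≡ just t × u ≡ node (sprout t ∷ [])
sproutChildren-!?⁻ (t ∷ ts) zero refl = t , refl , refl
sproutChildren-!?⁻ (t ∷ ts) (suc a) e = sproutChildren-!?⁻ ts a e

IsNode-sprout-∷⁺ : ∀ ts a q {t} → ts !? a ≡ just t → IsNode (sprout t) q →
                   IsNode (sprout (node ts)) (suc (suc a) ∷ 0 ∷ q)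
IsNode-sprout-∷⁺ ts a q e =
  IsNode-∷⁺ (node [] ∷ node [] ∷ sproutChildren ts) (suc (suc a)) (0 ∷ q) (sproutChildren-!? ts a e)

IsNode-sprout-∷⁻ : ∀ ts a q → IsNode (sprout (node ts)) (suc (suc a) ∷ q) →
                   ∃ λ t → ts !? a ≡ just t × IsNode (node (sprout t ∷ [])) q
IsNode-sprout-∷⁻ ts a q h with IsNode-∷⁻ (node [] ∷ node [] ∷ sproutChildren ts) (suc (suc a)) q h
... | _ , e , hq with sproutChildren-!?⁻ ts a e
...   | t , e′ , refl = t , e′ , hq

IsNode-ι++ : ∀ t p {k} → k ≤ 1 → IsNode t p → IsNode (sprout t) (ι p ++ k ∷ [])
IsNode-ι++ (node ts) [] z≤n _ = tt
IsNode-ι++ (node ts) [] (s≤s z≤n) _ = tt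
IsNode-ι++ (node ts) (a ∷ p) {k} k≤1 h with IsNode-∷⁻ ts a p h
... | t , e , hp = subst (λ z → IsNode (sprout (node ts)) (z ++ k ∷ [])) (sym (ι-∷ a p))
                         (IsNode-sprout-∷⁺ ts a (ι p ++ k ∷ []) e (IsNode-ι++ t p k≤1 hp))

IsNode-ι : ∀ t p → IsNode t p → IsNode (sprout t) (ι p)
IsNode-ι t p = IsNode-⊑ (p⊑p++q (ι p) (0 ∷ [])) ∘ IsNode-ι++ t p z≤n

IsNode-collapse : ∀ t κ q → IsNode (sprout t) q → IsNode t (collapse κ q)
IsNode-collapse (node ts) κ (suc (suc a) ∷ []) h with IsNode-sprout-∷⁻ ts a [] h
... | _ , e , _ with κ (a ∷ [])
...   | true = IsNode-∷⁺ ts a [] e tt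
...   | false = tt
IsNode-collapse (node ts) κ (suc (suc a) ∷ 0 ∷ r) h with IsNode-sprout-∷⁻ ts a (0 ∷ r) h
... | t , e , hr = IsNode-∷⁺ ts a (collapse (κ ∘ (a ∷_)) r) e (IsNode-collapse t (κ ∘ (a ∷_)) r hr)
IsNode-collapse t κ [] _ = tt
IsNode-collapse t κ (0 ∷ _) _ = tt
IsNode-collapse t κ (1 ∷ _) _ = tt
IsNode-collapse t κ (suc (suc a) ∷ suc b ∷ r) _ = tt

!?-< : {A : Set} (xs : List A) (a : ℕ) {x : A} → xs !? a ≡ just x → a < length xs
!?-< (x ∷ xs) zero _ = s≤s z≤n
!?-< (x ∷ xs) (suc a) e = s≤s (!?-< xs a e)

child-< : ∀ t p c r → IsNode t (p ++ c ∷ r) → c < succCount t p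
child-< (node ts) [] c r h with IsNode-∷⁻ ts c r h
... | t , e , _ = !?-< ts c e
child-< (node ts) (a ∷ p) c r h with IsNode-∷⁻ ts a (p ++ c ∷ r) h
... | t , e , h′ = subst (c <_) (sym (succCount-∷ ts a p e)) (child-< t p c r h′)

Lowerable : Tree → (List ℕ → Bool) → Set
Lowerable t κ = ∀ p → T (κ p) → succCount t p ≤ 1

Lowerable-∷ : ∀ ts a {t κ} → ts !? a ≡ just t → Lowerable (node ts) κ → Lowerable t (κ ∘ (a ∷_))
Lowerable-∷ ts a e L p κap = subst (_≤ 1) (succCount-∷ ts a p e) (L (a ∷ p) κap)

Lowerable-fork : ∀ t κ p {b c r r′} → Lowerable t κ →
                 IsNode t (p ++ b ∷ r) → IsNode t (p ++ c ∷ r′) → b ≢ c → κ p ≡ false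
Lowerable-fork t κ p {b} {c} {r} {r′} L hb hc b≢c with κ p in κp
... | false = refl
... | true = ⊥-elim (b≢c (trans (only-child b r hb) (sym (only-child c r′ hc))))
  where
  only-child : ∀ d r → IsNode t (p ++ d ∷ r) → d ≡ 0
  only-child d r h = n<1⇒n≡0 (<-≤-trans (child-< t p d r h) (L p (Equivalence.from T-≡ κp)))

LcpLift : List ℕ → Set
LcpLift p = ∀ t κ → Lowerable t κ → ∀ q → IsNode t p → IsNode t q →
            lcp (lift κ p) (lift κ q) ≡ lift κ (lcp p q)

lcp-liftBelow : ∀ ts κ → Lowerable (node ts) κ → ∀ a {t} → ts !? a ≡ just t →
                ∀ p q → LcpLift p → IsNode t p → IsNode t q →
                lcp (liftBelow κ a p) (liftBelow κ a q) ≡ liftBelow κ a (lcp p q)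
lcp-liftBelow ts κ L a e [] q _ _ _ = ⊑⇒lcp≡ (liftBelow-[]-⊑ κ a q)
lcp-liftBelow ts κ L a e (b ∷ p) [] _ _ _ with κ (a ∷ [])
... | true = refl
... | false = refl
lcp-liftBelow ts κ L a {t} e (b ∷ p) (c ∷ q) ih hp hq with b ≟ c
... | yes refl = cong (0 ∷_) (trans (ih t κa (Lowerable-∷ ts a e L) (b ∷ q) hp hq) (cong (lift κa) (lcp-∷ b p q)))
  where κa = κ ∘ (a ∷_)
... | no b≢c = begin
  0 ∷ lcp (lift κa (b ∷ p)) (lift κa (c ∷ q))  ≡⟨ cong (0 ∷_) (lcp-∷-≢ (b≢c ∘ suc-injective ∘ suc-injective)) ⟩
  0 ∷ []                                        ≡⟨ cong (λ z → if z then [] else 0 ∷ []) κa≡false ⟨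
  liftBelow κ a []                              ∎
  where
  open ≡-Reasoning
  κa = κ ∘ (a ∷_)
  κa≡false : κ (a ∷ []) ≡ false
  κa≡false = Lowerable-fork (node ts) κ (a ∷ []) L
               (IsNode-∷⁺ ts a (b ∷ p) e hp) (IsNode-∷⁺ ts a (c ∷ q) e hq) b≢c

lcp-lift : ∀ p → LcpLift p
lcp-lift [] t κ L q _ _ = refl
lcp-lift (a ∷ p) t κ L [] _ _ = refl
lcp-lift (a ∷ p) (node ts) κ L (b ∷ q) hp hq with a ≟ b
... | no a≢b = lcp-∷-≢ (a≢b ∘ suc-injective ∘ suc-injective)
... | yes refl = let (t , e , hp′) = IsNode-∷⁻ ts a p hp in
  trans (lcp-∷ _ _ _) (cong (suc (suc a) ∷_) (lcp-liftBelow ts κ L a e p q (lcp-lift p) hp′ (IsNode-child ts a q e hq)))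

liftNode : ∀ {t} → (List ℕ → Bool) → Node t → Node (sprout t)
liftNode {t} κ (p , hp) = lift κ p , IsNode-⊑ (lift-⊑-ι κ p) (IsNode-ι t p hp)

lift-isEmbedding : ∀ {t} κ → Lowerable t κ → IsEmbedding (liftNode {t} κ)
lift-isEmbedding {t} κ L = record
  { root↦root = refl
  ; strict    = λ _ _ → lift-<L κ
  ; meet-pres = λ x y → sym (lcp-lift (path x) t κ L (path y) (proj₂ x) (proj₂ y))
  }

collapseHom : (S : Tree) (κ : List ℕ → Bool) → Lowerable S κ → Hom S (sprout S)
collapseHom S κ L = record
  { s       = λ y → collapse κ (path y) , IsNode-collapse S κ (path y) (proj₂ y)
  ; i       = liftNode (λ _ → false)
  ; s-rigid = liftNode κ
            , lift-isEmbedding κ L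
            , (λ x → collapse-lift κ κ (path x) (λ κx → κx))
            , (λ y → lift-collapse-⊑ κ (path y))
  ; i-emb   = lift-isEmbedding (λ _ → false) (λ _ ())
  ; section = λ x → collapse-lift κ (λ _ → false) (path x) (λ ())
  ; below   = λ x y → collapse-below-ι κ (path x) (path y)
  }

∈-allPathsL⁻ : ∀ i ts p → p ∈ allPathsL i ts →
               ∃ λ j → ∃ λ q → ∃ λ t → p ≡ (i + j) ∷ q × ts !? j ≡ just t × q ∈ allPaths t
∈-allPathsL⁻ i (t ∷ ts) p p∈ with ∈-++⁻ (map (i ∷_) (allPaths t)) p∈
... | inj₁ p∈here with ∈-map⁻ (i ∷_) p∈here
...   | q , q∈ , refl = 0 , q , t , cong (_∷ q) (sym (+-identityʳ i)) , refl , q∈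
∈-allPathsL⁻ i (t ∷ ts) p p∈ | inj₂ p∈rest with ∈-allPathsL⁻ (suc i) ts p p∈rest
... | j , q , u , refl , e , q∈ = suc j , q , u , cong (_∷ q) (sym (+-suc i j)) , e , q∈

∈-allPaths⇒IsNode : ∀ t p → p ∈ allPaths t → IsNode t p
∈-allPaths⇒IsNode (node ts) p (here refl) = tt
∈-allPaths⇒IsNode (node ts) p (there p∈) with ∈-allPathsL⁻ 0 ts p p∈
... | j , q , t , refl , e , q∈ = IsNode-∷⁺ ts j q e (∈-allPaths⇒IsNode t q q∈)

allPaths-unique : ∀ t → Unique (allPaths t)
allPathsL-unique : ∀ i ts → Unique (allPathsL i ts)
allPaths-unique (node ts) = All.tabulate []∉ ∷ allPathsL-unique 0 ts
  where
  []∉ : ∀ {p} → p ∈ allPathsL 0 ts → [] ≢ p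
  []∉ p∈ with ∈-allPathsL⁻ 0 ts _ p∈
  ... | _ , _ , _ , refl , _ = λ ()
allPathsL-unique i [] = []
allPathsL-unique i (t ∷ ts) =
  Unique.++⁺ (Unique.map⁺ ∷-injectiveʳ (allPaths-unique t)) (allPathsL-unique (suc i) ts) disjoint
  where
  disjoint : ∀ {p} → ¬ (p ∈ map (i ∷_) (allPaths t) × p ∈ allPathsL (suc i) ts)
  disjoint (p∈here , p∈rest) with ∈-map⁻ (i ∷_) p∈here
  ... | _ , _ , refl with ∈-allPathsL⁻ (suc i) ts _ p∈rest
  ...   | j , _ , _ , e , _ = <-irrefl (∷-injectiveˡ e) (s≤s (m≤m+n i j))

∈-lowSet⁻ : ∀ t p → p ∈ lowSet t → IsNode t p × p ≢ [] × succCount t p ≤ 1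
∈-lowSet⁻ t p p∈ with ∈-filter⁻ (λ p → nonRoot? p ×-dec (succCount t p ≤? 1)) {xs = allPaths t} p∈
... | p∈all , low = ∈-allPaths⇒IsNode t p p∈all , low

lowSet-unique : ∀ t → Unique (lowSet t)
lowSet-unique t = Unique.filter⁺ (λ p → nonRoot? p ×-dec (succCount t p ≤? 1)) (allPaths-unique t)

module _ {A : Set} where

  code : (A → Bool) → (xs : List A) → Fin (2 ^ length xs)
  code φ [] = zero
  code φ (x ∷ xs) = combine (Inverse.from 2↔Bool (φ x)) (code φ xs)

  code-cong : ∀ {φ ψ} xs → (∀ {x} → x ∈ xs → φ x ≡ ψ x) → code φ xs ≡ code ψ xs
  code-cong [] _ = refl
  code-cong (x ∷ xs) φ≗ψ =
    cong₂ combine (cong (Inverse.from 2↔Bool) (φ≗ψ (here refl))) (code-cong xs (φ≗ψ ∘ there))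

  code-surjective : DecidableEquality A → ∀ {xs} → Unique xs →
                    (c : Fin (2 ^ length xs)) → ∃ λ φ → code φ xs ≡ c
  code-surjective _≟_ {[]} [] zero = (λ _ → false) , refl
  code-surjective _≟_ {x ∷ xs} (x∉xs ∷ xs!) c = ψ , (begin
    combine (from (ψ x)) (code ψ xs)     ≡⟨ cong₂ combine (cong from ψx≡) (code-cong xs ψ≗φ) ⟩
    combine (from (to bit)) (code φ xs)  ≡⟨ cong₂ combine (strictlyInverseʳ bit) φ-code ⟩
    combine bit rest                     ≡⟨ combine-remQuot (2 ^ length xs) c ⟩
    c                                    ∎)
    where
    open ≡-Reasoning
    open Inverse 2↔Bool
    bit = proj₁ (remQuot (2 ^ length xs) c)
    rest = proj₂ (remQuot (2 ^ length xs) c)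
    φ = proj₁ (code-surjective _≟_ xs! rest)
    φ-code = proj₂ (code-surjective _≟_ xs! rest)
    ψ : A → Bool
    ψ y = if does (y ≟ x) then to bit else φ y
    ψx≡ : ψ x ≡ to bit
    ψx≡ = cong (if_then to bit else φ x) (dec-true (x ≟ x) refl)
    ψ≗φ : ∀ {y} → y ∈ xs → ψ y ≡ φ y
    ψ≗φ {y} y∈ = cong (if_then to bit else φ y) (dec-false (y ≟ x) (All.lookup x∉xs y∈ ∘ sym))

covering⇒≤length : ∀ {m} (L : List (Fin m)) → (∀ c → c ∈ L) → m ≤ length L
covering⇒≤length L covers = injective⇒≤ λ {c} {d} e →
  trans (lookup-index (covers c)) (trans (cong (lookup L) e) (sym (lookup-index (covers d))))

lcp-fork : ∀ m → lcp (m ++ 0 ∷ []) (m ++ 1 ∷ []) ≡ m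
lcp-fork [] = refl
lcp-fork (a ∷ m) = trans (lcp-∷ a _ _) (cong (a ∷_) (lcp-fork m))

m++[k]≢m : ∀ (m : List ℕ) k → m ++ k ∷ [] ≢ m
m++[k]≢m m k e with ++-identityʳ-unique m (sym e)
... | ()

lowered : ∀ {S C} → Hom S C → Node S → Bool
lowered h x = not (does (path (witness h x) ≟ₚ path (Connection.i h x)))

loweredAt : ∀ {S C} → Hom S C → List ℕ → Bool
loweredAt {S} h p with T? (is-just (subAt S p))
... | yes hp = lowered h (p , hp)
... | no _ = false

loweredAt-path : ∀ {S C} (h : Hom S C) (x : Node S) → loweredAt h (path x) ≡ lowered h x
loweredAt-path {S} h (p , hp) with T? (is-just (subAt S p))
... | yes hp′ = cong (lowered h ∘ (p ,_)) (T-irrelevant hp′ hp)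
... | no ¬hp = ⊥-elim (¬hp hp)

loweredAt-≈ : ∀ {S C} (h h′ : Hom S C) → h ≈H h′ → ∀ p → loweredAt h p ≡ loweredAt h′ p
loweredAt-≈ {S} h h′ (s≡s′ , i≡i′) p with T? (is-just (subAt S p))
... | yes hp = cong₂ (λ u v → not (does (u ≟ₚ v)))
                     (rigidWitness-unique (Connection.s-rigid h) (Connection.s-rigid h′) s≡s′ (p , hp))
                     (i≡i′ (p , hp))
... | no _ = refl

colouring : ∀ S C → Coloring S C (powerSetSize S)
colouring S C = (λ h → code (loweredAt h) (lowSet S))
              , (λ h h′ h≈h′ → code-cong (lowSet S) (λ {p} _ → loweredAt-≈ h h′ h≈h′ p))

lowered-∘-collapseHom : ∀ {S C} (f : Hom (sprout S) C) κ (L : Lowerable S κ) (x : Node S) →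
                        path x ≢ [] → lowered (f ∘ᶜ collapseHom S κ L) x ≡ κ (path x)
lowered-∘-collapseHom {S} f κ L x@(p , hp) p≢[] with κ p in κp
... | true = cong not (dec-false (_ ≟ₚ _) witness≢i)
  where
  witness≢i : path (witness f (liftNode κ x)) ≢ path (Connection.i f (liftNode (λ _ → false) x))
  witness≢i = witness≢i-below f _ _ (lift-⊑-ι κ p) (lift-≢-ι κ p p≢[] κp)
... | false = cong not (dec-true (_ ≟ₚ _) witness≡i)
  where
  ιx ιx0 ιx1 : Node (sprout S)
  ιx = liftNode (λ _ → false) x
  ιx0 = ι p ++ 0 ∷ [] , IsNode-ι++ S p z≤n hp
  ιx1 = ι p ++ 1 ∷ [] , IsNode-ι++ S p (s≤s z≤n) hp
  witness≡i : path (witness f (liftNode κ x)) ≡ path (Connection.i f ιx)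
  witness≡i = trans (path-cong (witness f) (lift-≡-ι κ p κp))
                    (witness≡i-at-fork f ιx ιx0 ιx1 (lcp-fork (ι p)) (m++[k]≢m (ι p) 0) (m++[k]≢m (ι p) 1))

lowering : Tree → (List ℕ → Bool) → List ℕ → Bool
lowering S ρ p = ρ p ∧ (succCount S p ≤ᵇ 1)

lowering-lowerable : ∀ S ρ → Lowerable S (lowering S ρ)
lowering-lowerable S ρ p = ≤ᵇ⇒≤ (succCount S p) 1 ∘ proj₂ ∘ Equivalence.to T-∧

f∘Hom-hits-every-colour : ∀ {S C} (f : Hom (sprout S) C) (c : Fin (powerSetSize S)) →
                        ∃ λ g → proj₁ (colouring S C) (f ∘ᶜ g) ≡ c
f∘Hom-hits-every-colour {S} f c = g , trans (code-cong (lowSet S) colour≗ρ) ρ-code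
  where
  ρ = proj₁ (code-surjective _≟ₚ_ (lowSet-unique S) c)
  ρ-code = proj₂ (code-surjective _≟ₚ_ (lowSet-unique S) c)
  g = collapseHom S (lowering S ρ) (lowering-lowerable S ρ)
  colour≗ρ : ∀ {p} → p ∈ lowSet S → loweredAt (f ∘ᶜ g) p ≡ ρ p
  colour≗ρ {p} p∈ with ∈-lowSet⁻ S p p∈
  ... | hp , p≢[] , small = begin
    loweredAt (f ∘ᶜ g) p        ≡⟨ loweredAt-path (f ∘ᶜ g) (p , hp) ⟩
    lowered (f ∘ᶜ g) (p , hp)   ≡⟨ lowered-∘-collapseHom f (lowering S ρ) (lowering-lowerable S ρ) (p , hp) p≢[] ⟩
    ρ p ∧ (succCount S p ≤ᵇ 1)  ≡⟨ cong (ρ p ∧_) (Equivalence.to T-≡ (≤⇒≤ᵇ small)) ⟩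
    ρ p ∧ true                  ≡⟨ ∧-identityʳ (ρ p) ⟩
    ρ p                         ∎
    where open ≡-Reasoning

lemma3p3 : (S : Tree) → RdAtLeast S (powerSetSize S)
lemma3p3 S k bounded with bounded (sprout S) (powerSetSize S) (m^n>0 2 (length (lowSet S)))
... | C , ramsey with ramsey (colouring S C)
...   | f , L , |L|≤k , f∘Hom⊆L = ≤-trans (covering⇒≤length L covered) |L|≤k
  where
  covered : ∀ c → c ∈ L
  covered c = let (g , colour≡c) = f∘Hom-hits-every-colour f c in
              subst (_∈ L) colour≡c (f∘Hom⊆L g (f ∘ᶜ g) ((λ _ → refl) , (λ _ → refl)))
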